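{- Let $\mathbf{d}_n=(d_1,\dots,d_n)$ be a degree sequence, $w\in[n]$, and let $\hat n$, $V_w$ and $\mathbf{d}_{n,w}$ be as in the context, with $\hat n<n$. Let $\mathfrak{s}_{n,w}(w)$ be the six-length of $w$ in a random functional graph on $V_w$ with degree sequence $\mathbf{d}_{n,w}$. Then $$\mathfrak{s}_n(w)\overset{d}{=}\mathcal{R}\big(n-\hat n,\ \mathfrak{s}_{n,w}(w),\ \hat n+1-\mathfrak{s}_{n,w}(w)\big),$$ where the family $\{\mathcal{R}(m,a,b)\}$ is independent of $\mathfrak{s}_{n,w}(w)$.
   Context: A degree sequence is $(d_1,\dots,d_n)\in\mathbb{N}_0^n$ with $\sum_j d_j=n$. For a finite set $V$ and $(d_v)_{v\in V}$ with $\sum d_v=|V|$, a random functional graph on $V$ with degree sequence $(d_v)$ is given by $F$ uniform on $\{f:V\to V: |f^{ -1}(\{v\})|=d_v\ \forall v\}$. Six-length: $\mathfrak{s}_f(v)=\min\{k\in\mathbb{N}: f^{(k)}(v)\in\{f^{(j)}(v):0\le j\le k-1\}\}$ ($f^{(k)}$ the $k$-fold composition, $f^{(0)}=\mathrm{id}$); $\mathfrak{s}_n(w)$ is the six-length of $w$ in a random functional graph on $[n]$ with degree sequence $\mathbf{d}_n$. Let $\sigma^2(\mathbf{d}_n)=\frac1n\sum_j d_j^2-1$ and $\hat n=\lfloor (n\sigma^2(\mathbf{d}_n))^{4/3}\rfloor$. When $\hat n<n$, let $k=n-\hat n$, let $v_1,\dots,v_k$ be $k$ vertices of $[n]\setminus\{w\}$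 with $d_{v_i}=1$, chosen by a fixed canonical rule, $V_w=[n]\setminus\{v_1,\dots,v_k\}$ (so $|V_w|=\hat n$), and $\mathbf{d}_{n,w}=(d_v)_{v\in V_w}$. A classical $(a,b)$-Pólya urn starts with $a$ red and $b$ blue balls; at each step a ball is drawn uniformly at random and returned together with another ball of the same colour. $\mathcal{R}(m,a,b)$ denotes the number of red balls after $m$ balls have been added. -}

module Defs where

open import Data.Nat using (ℕ; zero; suc; _+_; _*_; _∸_; _≡ᵇ_)
open import Data.Bool using (Bool; true; false; if_then_else_)
open import Data.Fin using (Fin; zero; suc)
open import Data.Fin.Properties using (_≟_)
open import Data.List using (List; []; _∷_; map; concatMap; length; filterᵇ; upTo; allFin)
open import Data.Nat.ListAction using (sum)
open import Data.Bool.ListAction using (all; any)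
open import Relation.Nullary.Decidable using (⌊_⌋)

_==_ : ∀ {n} → Fin n → Fin n → Bool
i == j = ⌊ i ≟ j ⌋

ΣF : ∀ n → (Fin n → ℕ) → ℕ
ΣF n f = sum (map f (allFin n))

countᵇ : ∀ {A : Set} → (A → Bool) → List A → ℕ
countᵇ p xs = length (filterᵇ p xs)

-- Enumeration of all maps Fin k → Fin n (each map exactly once, up to
-- pointwise equality)

cons : ∀ {k n} → Fin n → (Fin k → Fin n) → Fin (suc k) → Fin n
cons i g zero    = i
cons i g (suc x) = g x

funs : (k n : ℕ) → List (Fin k → Fin n)
funs zero    n = (λ ()) ∷ []
funs (suc k) n = concatMap (λ i → map (cons i) (funs k n)) (allFin n)

indeg : ∀ {n} → (Fin n → Fin n) → Fin n → ℕ
indeg {n} f v = countᵇ (λ u → f u == v) (allFin n)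

hasDegSeq : ∀ {n} → (Fin n → ℕ) → (Fin n → Fin n) → Bool
hasDegSeq {n} d f = all (λ v → indeg f v ≡ᵇ d v) (allFin n)

-- the (finite) support of the uniform random functional graph
FunGraphs : ∀ n → (Fin n → ℕ) → List (Fin n → Fin n)
FunGraphs n d = filterᵇ (hasDegSeq d) (funs n n)

iter : ∀ {n} → (Fin n → Fin n) → ℕ → Fin n → Fin n
iter f zero    v = v
iter f (suc k) v = f (iter f k v)

revisits : ∀ {n} → (Fin n → Fin n) → Fin n → ℕ → Bool
revisits f v k = any (λ j → iter f k v == iter f j v) (upTo k)

-- least k ∈ {start, …, start + fuel - 1} with revisits f v k
-- (returns start + fuel if there is none)
search : ∀ {n} → (Fin n → Fin n) → Fin n → ℕ → ℕ → ℕ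
search f v k zero       = k
search f v k (suc fuel) = if revisits f v k then k else search f v (suc k) fuel

-- 𝔰_f(v) = min { k ≥ 1 : f^(k)(v) ∈ {f^(j)(v) : j < k} }.
-- By pigeonhole this minimum is ≤ n, so searching k = 1, …, n suffices.
sixLen : ∀ {n} → (Fin n → Fin n) → Fin n → ℕ
sixLen {n} f v = search f v 1 n

FGCount : ∀ n → (Fin n → ℕ) → ℕ
FGCount n d = length (FunGraphs n d)

-- number of those in which the six-length of w equals k
-- (so P(𝔰_n(w) = k) = SixLenCount n d w k / FGCount n d)
SixLenCount : ∀ n → (Fin n → ℕ) → Fin n → ℕ → ℕ
SixLenCount n d w k = countᵇ (λ f → sixLen f w ≡ᵇ k) (FunGraphs n d)

-- n σ²(d) = Σ d_j² - n   (a natural number, since d_j² ≥ d_j and Σ d_j = n)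
nσ² : ∀ n → (Fin n → ℕ) → ℕ
nσ² n d = ΣF n (λ j → d j * d j) ∸ n

-- P(ℛ(m,a,b) = r) = urnNum m a b r / urnDen m (a + b),
-- obtained by conditioning on the first draw:
--   P_{m+1}(a,b,r) = a/(a+b) P_m(a+1,b,r) + b/(a+b) P_m(a,b+1,r),
--   P_0(a,b,r) = [r = a].
urnNum : ℕ → ℕ → ℕ → ℕ → ℕ
urnNum zero    a b r = if a ≡ᵇ r then 1 else 0
urnNum (suc m) a b r = a * urnNum m (suc a) b r + b * urnNum m a (suc b) r

-- t (t+1) ⋯ (t+m-1), with t the total number of balls
urnDen : ℕ → ℕ → ℕ
urnDen zero    t = 1
urnDen (suc m) t = t * urnDen m (suc t)

-- A functional graph on Fin (suc N) in which a vertex u has in-degree one is the same thing as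
-- a functional graph g on the other N vertices together with the unique preimage p of u: u is
-- inserted into the edge leaving p. The other in-degrees are unchanged, so the number of graphs
-- with the given degree sequence is multiplied by N + 1. If p lies on the first 𝔰 iterates of w
-- under g (𝔰 the six-length of w in g) the insertion lengthens the six-length by one, otherwise it
-- is unchanged: one step of a Pólya urn with 𝔰 red and N + 1 − 𝔰 blue balls. Removing the n − n̂
-- vertices of degree one outside the image of e one at a time composes these urn steps.

module Submission where

open import Data.Bool using (Bool; true; false; if_then_else_; not; T)
open import Data.Bool.ListAction using (any)
open import Data.Empty using (⊥-elim)
open import Data.Fin using (Fin; zero; suc; toℕ; punchIn; punchOut)
open import Data.Fin.Properties
  using ( _≟_; all?; any?; ¬∀⟶∃¬; suc-injective; toℕ-injective; toℕ<n; injective⇒≤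
        ; punchIn-injective; punchInᵢ≢i; punchOut-injective)
  renaming (≡-decSetoid to Fin-decSetoid)
open import Data.List using (List; []; _∷_; map; concatMap; filterᵇ; _++_; allFin; upTo; cartesianProduct; length)
open import Data.List.Properties using (map-tabulate; upTo-∷ʳ; length-upTo; length-tabulate)
open import Data.List.Membership.Propositional using (_∈_; find; lose)
open import Data.List.Membership.Propositional.Properties using (∈-upTo⁺; ∈-upTo⁻)
open import Data.List.Relation.Unary.All.Properties using (all⁺; all⁻; tabulate⁺; tabulate⁻)
open import Data.List.Relation.Unary.Any using (here; there)
open import Data.List.Relation.Unary.Any.Properties using (any⁺; any⁻)
open import Data.Nat using (ℕ; zero; suc; _+_; _*_; _∸_; _^_; _≤_; _<_; z≤n; s≤s; _≡ᵇ_)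
open import Data.Nat.ListAction using (sum)
open import Data.Nat.Properties hiding (_≟_; suc-injective)
open import Data.Nat.Properties using () renaming (_≟_ to _≟ℕ_)
open import Algebra.Properties.CommutativeSemigroup +-commutativeSemigroup using (interchange)
open import Data.Nat.Tactic.RingSolver using (solve-∀)
open import Data.Product using (∃; _×_; _,_; proj₁; proj₂)
open import Data.Product.Relation.Binary.Pointwise.NonDependent using (×-decSetoid)
open import Data.Sum using (_⊎_; inj₁; inj₂)
open import Data.Unit using (tt)
open import Function using (_∘_; id; flip; _⇔_; mk⇔; Equivalence)
open import Function.Definitions using (Injective)
open import Level using (0ℓ)
open import Relation.Binary.Bundles using (DecSetoid)
open import Relation.Binary.Definitions using (tri<; tri≈; tri>)
open import Relation.Binary.PropositionalEquality using (_≡_; _≢_; _≗_; refl; sym; trans; cong; cong₂; subst; module ≡-Reasoning)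
open import Relation.Nullary using (¬_; Dec; yes; no; _×-dec_)
open import Relation.Nullary.Decidable using (⌊_⌋; ⌊⌋-map′; toWitness; fromWitness; decidable-stable)
open import Defs

private
  variable
    X Y : Set

𝟙 : Bool → ℕ
𝟙 b = if b then 1 else 0

𝟙-+-𝟙-not : ∀ b → 𝟙 b + 𝟙 (not b) ≡ 1
𝟙-+-𝟙-not true  = refl
𝟙-+-𝟙-not false = refl

T-⇔⇒≡ : ∀ {a b} → (T a → T b) → (T b → T a) → a ≡ b
T-⇔⇒≡ {true}  {true}  _  _  = refl
T-⇔⇒≡ {true}  {false} to _  = ⊥-elim (to _)
T-⇔⇒≡ {false} {true}  _ from = ⊥-elim (from _)
T-⇔⇒≡ {false} {false} _  _  = refl

⌊⌋-⇔ : ∀ {P Q : Set} → P ⇔ Q → (p? : Dec P) (q? : Dec Q) → ⌊ p? ⌋ ≡ ⌊ q? ⌋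
⌊⌋-⇔ P⇔Q (yes p) (yes q) = refl
⌊⌋-⇔ P⇔Q (yes p) (no ¬q) = ⊥-elim (¬q (Equivalence.to P⇔Q p))
⌊⌋-⇔ P⇔Q (no ¬p) (yes q) = ⊥-elim (¬p (Equivalence.from P⇔Q q))
⌊⌋-⇔ P⇔Q (no ¬p) (no ¬q) = refl

𝟙-×-dec : ∀ {P Q : Set} (p? : Dec P) (q? : Dec Q) → 𝟙 ⌊ p? ×-dec q? ⌋ ≡ 𝟙 ⌊ p? ⌋ * 𝟙 ⌊ q? ⌋
𝟙-×-dec (yes _) (yes _) = refl
𝟙-×-dec (yes _) (no _)  = refl
𝟙-×-dec (no _)  q? = refl

𝟙-≡ᵇ-≢ : ∀ {a b} → a ≢ b → 𝟙 (a ≡ᵇ b) ≡ 0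
𝟙-≡ᵇ-≢ {a} {b} a≢b with a ≡ᵇ b in eq
... | true  = ⊥-elim (a≢b (≡ᵇ⇒≡ a b (subst T (sym eq) _)))
... | false = refl

𝟙-≡ᵇ-refl : ∀ a → 𝟙 (a ≡ᵇ a) ≡ 1
𝟙-≡ᵇ-refl a with a ≡ᵇ a in eq
... | true  = refl
... | false = ⊥-elim (subst T eq (≡⇒≡ᵇ a a refl))

==-refl : ∀ {n} (i : Fin n) → (i == i) ≡ true
==-refl i with i ≟ i
... | yes _ = refl
... | no i≢i = ⊥-elim (i≢i refl)

==-≢ : ∀ {n} {i j : Fin n} → i ≢ j → (i == j) ≡ false
==-≢ {i = i} {j} i≢j with i ≟ j
... | yes i≡j = ⊥-elim (i≢j i≡j)
... | no _    = refl

∑ : List X → (X → ℕ) → ℕ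
∑ xs f = sum (map f xs)

syntax ∑ xs (λ x → e) = ∑[ x ∈ xs ] e

∑-cong : ∀ (xs : List X) {f g : X → ℕ} → (∀ x → f x ≡ g x) → ∑ xs f ≡ ∑ xs g
∑-cong []       eq = refl
∑-cong (x ∷ xs) eq = cong₂ _+_ (eq x) (∑-cong xs eq)

∑-cong-∈ : ∀ (xs : List X) {f g : X → ℕ} → (∀ {x} → x ∈ xs → f x ≡ g x) → ∑ xs f ≡ ∑ xs g
∑-cong-∈ []       eq = refl
∑-cong-∈ (x ∷ xs) eq = cong₂ _+_ (eq (here refl)) (∑-cong-∈ xs (eq ∘ there))

∑-zero : ∀ (xs : List X) → ∑[ x ∈ xs ] 0 ≡ 0
∑-zero []       = refl
∑-zero (x ∷ xs) = ∑-zero xs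

∑-distrib-+ : ∀ (xs : List X) (f g : X → ℕ) → ∑[ x ∈ xs ] (f x + g x) ≡ ∑ xs f + ∑ xs g
∑-distrib-+ []       f g = refl
∑-distrib-+ (x ∷ xs) f g =
  trans (cong (f x + g x +_) (∑-distrib-+ xs f g)) (interchange (f x) (g x) (∑ xs f) (∑ xs g))

*-distribˡ-∑ : ∀ (xs : List X) c (f : X → ℕ) → ∑[ x ∈ xs ] (c * f x) ≡ c * ∑ xs f
*-distribˡ-∑ []       c f = sym (*-zeroʳ c)
*-distribˡ-∑ (x ∷ xs) c f =
  trans (cong (c * f x +_) (*-distribˡ-∑ xs c f)) (sym (*-distribˡ-+ c (f x) (∑ xs f)))

*-distribʳ-∑ : ∀ (xs : List X) c (f : X → ℕ) → ∑[ x ∈ xs ] (f x * c) ≡ ∑ xs f * c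
*-distribʳ-∑ xs c f =
  trans (∑-cong xs (λ x → *-comm (f x) c)) (trans (*-distribˡ-∑ xs c f) (*-comm c (∑ xs f)))

∑-const : ∀ (xs : List X) c → ∑[ x ∈ xs ] c ≡ length xs * c
∑-const []       c = refl
∑-const (x ∷ xs) c = cong (c +_) (∑-const xs c)

∑-mono-≤ : ∀ (xs : List X) {f g : X → ℕ} → (∀ x → f x ≤ g x) → ∑ xs f ≤ ∑ xs g
∑-mono-≤ []       le = z≤n
∑-mono-≤ (x ∷ xs) le = +-mono-≤ (le x) (∑-mono-≤ xs le)

∑-select : ∀ (xs : List X) (p : X → Bool) (h : X → ℕ) {c} → (∀ x → T (p x) → h x ≡ c) →
           ∑[ x ∈ xs ] 𝟙 (p x) ≡ 1 → ∑[ x ∈ xs ] (𝟙 (p x) * h x) ≡ c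
∑-select xs p h {c} h≡c once = begin
  ∑[ x ∈ xs ] (𝟙 (p x) * h x)  ≡⟨ ∑-cong xs at-c ⟩
  ∑[ x ∈ xs ] (𝟙 (p x) * c)    ≡⟨ *-distribʳ-∑ xs c (𝟙 ∘ p) ⟩
  ∑[ x ∈ xs ] 𝟙 (p x) * c      ≡⟨ cong (_* c) once ⟩
  1 * c                        ≡⟨ *-identityˡ c ⟩
  c                            ∎
  where
  open ≡-Reasoning
  at-c : ∀ x → 𝟙 (p x) * h x ≡ 𝟙 (p x) * c
  at-c x with p x in eq
  ... | true  = cong (_+ 0) (h≡c x (subst T (sym eq) _))
  ... | false = refl

∑-++ : ∀ (xs ys : List X) (f : X → ℕ) → ∑ (xs ++ ys) f ≡ ∑ xs f + ∑ ys f
∑-++ []       ys f = refl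
∑-++ (x ∷ xs) ys f = trans (cong (f x +_) (∑-++ xs ys f)) (sym (+-assoc (f x) (∑ xs f) (∑ ys f)))

countᵇ≡∑ : ∀ (p : X → Bool) xs → countᵇ p xs ≡ ∑[ x ∈ xs ] 𝟙 (p x)
countᵇ≡∑ p []       = refl
countᵇ≡∑ p (x ∷ xs) with p x
... | true  = cong suc (countᵇ≡∑ p xs)
... | false = countᵇ≡∑ p xs

∑-filterᵇ : ∀ (p : X → Bool) xs (f : X → ℕ) → ∑ (filterᵇ p xs) f ≡ ∑[ x ∈ xs ] (𝟙 (p x) * f x)
∑-filterᵇ p []       f = refl
∑-filterᵇ p (x ∷ xs) f with p x
... | true  = cong₂ _+_ (sym (+-identityʳ (f x))) (∑-filterᵇ p xs f)
... | false = ∑-filterᵇ p xs f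

countᵇ-filterᵇ : ∀ (p q : X → Bool) xs → countᵇ q (filterᵇ p xs) ≡ ∑[ x ∈ xs ] (𝟙 (p x) * 𝟙 (q x))
countᵇ-filterᵇ p q xs = trans (countᵇ≡∑ q (filterᵇ p xs)) (∑-filterᵇ p xs (𝟙 ∘ q))

∑-map : ∀ (xs : List X) (c : X → Y) (f : Y → ℕ) → ∑ (map c xs) f ≡ ∑ xs (f ∘ c)
∑-map []       c f = refl
∑-map (x ∷ xs) c f = cong (f (c x) +_) (∑-map xs c f)

∑-concatMap : ∀ (xs : List X) (F : X → List Y) (f : Y → ℕ) →
              ∑ (concatMap F xs) f ≡ ∑[ x ∈ xs ] ∑ (F x) f
∑-concatMap []       F f = refl
∑-concatMap (x ∷ xs) F f =
  trans (∑-++ (F x) (concatMap F xs) f) (cong (∑ (F x) f +_) (∑-concatMap xs F f))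

∑-comm : ∀ (xs : List X) (ys : List Y) (f : X → Y → ℕ) →
         ∑[ x ∈ xs ] ∑[ y ∈ ys ] f x y ≡ ∑[ y ∈ ys ] ∑[ x ∈ xs ] f x y
∑-comm []       ys f = sym (∑-zero ys)
∑-comm (x ∷ xs) ys f = trans (cong (∑ ys (f x) +_) (∑-comm xs ys f))
                             (sym (∑-distrib-+ ys (f x) (λ y → ∑[ x′ ∈ xs ] f x′ y)))

∑-cartesianProduct : ∀ (xs : List X) (ys : List Y) (f : X × Y → ℕ) →
                     ∑ (cartesianProduct xs ys) f ≡ ∑[ x ∈ xs ] ∑[ y ∈ ys ] f (x , y)
∑-cartesianProduct []       ys f = refl
∑-cartesianProduct (x ∷ xs) ys f =
  trans (∑-++ (map (x ,_) ys) (cartesianProduct xs ys) f)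
        (cong₂ _+_ (∑-map ys (x ,_) f) (∑-cartesianProduct xs ys f))

module _ (S : DecSetoid 0ℓ 0ℓ) where
  open DecSetoid S using (Carrier; _≈_) renaming (_≟_ to _≈?_)

  Enumerates : List Carrier → Set
  Enumerates xs = ∀ a → ∑[ x ∈ xs ] 𝟙 ⌊ x ≈? a ⌋ ≡ 1

  enumeration-select : ∀ xs → Enumerates xs → (h : Carrier → ℕ) → (∀ {x y} → x ≈ y → h x ≡ h y) →
                       ∀ a → ∑[ x ∈ xs ] (𝟙 ⌊ x ≈? a ⌋ * h x) ≡ h a
  enumeration-select xs enum h h-cong a = ∑-select xs (λ x → ⌊ x ≈? a ⌋) h (λ x x≈a → h-cong (toWitness x≈a)) (enum a)

  enumeration-split : ∀ xs → Enumerates xs → (h : Carrier → ℕ) → (∀ {x y} → x ≈ y → h x ≡ h y) →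
                      ∀ a → ∑ xs h ≡ h a + ∑[ x ∈ xs ] (𝟙 (not ⌊ x ≈? a ⌋) * h x)
  enumeration-split xs enum h h-cong a = begin
    ∑[ x ∈ xs ] h x
      ≡⟨ ∑-cong xs (λ x → sym (trans (cong (_* h x) (𝟙-+-𝟙-not ⌊ x ≈? a ⌋)) (+-identityʳ (h x)))) ⟩
    ∑[ x ∈ xs ] ((𝟙 ⌊ x ≈? a ⌋ + 𝟙 (not ⌊ x ≈? a ⌋)) * h x)
      ≡⟨ ∑-cong xs (λ x → *-distribʳ-+ (h x) (𝟙 ⌊ x ≈? a ⌋) (𝟙 (not ⌊ x ≈? a ⌋))) ⟩
    ∑[ x ∈ xs ] (𝟙 ⌊ x ≈? a ⌋ * h x + 𝟙 (not ⌊ x ≈? a ⌋) * h x)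
      ≡⟨ ∑-distrib-+ xs (λ x → 𝟙 ⌊ x ≈? a ⌋ * h x) (λ x → 𝟙 (not ⌊ x ≈? a ⌋) * h x) ⟩
    ∑[ x ∈ xs ] (𝟙 ⌊ x ≈? a ⌋ * h x) + ∑[ x ∈ xs ] (𝟙 (not ⌊ x ≈? a ⌋) * h x)
      ≡⟨ cong (_+ ∑[ x ∈ xs ] (𝟙 (not ⌊ x ≈? a ⌋) * h x)) (enumeration-select xs enum h h-cong a) ⟩
    h a + ∑[ x ∈ xs ] (𝟙 (not ⌊ x ≈? a ⌋) * h x) ∎
    where open ≡-Reasoning

∑-allFin-suc : ∀ n (h : Fin (suc n) → ℕ) → ∑ (allFin (suc n)) h ≡ h zero + ∑[ x ∈ allFin n ] h (suc x)
∑-allFin-suc n h = cong (h zero +_) (trans (cong sum (map-tabulate suc h)) (sym (cong sum (map-tabulate id (h ∘ suc)))))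

∑-allFin-1 : ∀ n → ∑[ x ∈ allFin n ] 1 ≡ n
∑-allFin-1 n = trans (∑-const (allFin n) 1) (trans (*-identityʳ _) (length-tabulate {n = n} id))

allFin-enumerates : ∀ n → Enumerates (Fin-decSetoid n) (allFin n)
allFin-enumerates (suc n) zero    = trans (∑-allFin-suc n (λ x → 𝟙 ⌊ x ≟ zero ⌋)) (cong suc (∑-zero (allFin n)))
allFin-enumerates (suc n) (suc a) = begin
  ∑[ x ∈ allFin (suc n) ] 𝟙 ⌊ x ≟ suc a ⌋      ≡⟨ ∑-allFin-suc n (λ x → 𝟙 ⌊ x ≟ suc a ⌋) ⟩
  ∑[ x ∈ allFin n ] 𝟙 ⌊ suc x ≟ suc a ⌋
    ≡⟨ ∑-cong (allFin n) (λ x → cong 𝟙 (⌊⌋-map′ (cong suc) suc-injective (x ≟ a))) ⟩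
  ∑[ x ∈ allFin n ] 𝟙 ⌊ x ≟ a ⌋                ≡⟨ allFin-enumerates n a ⟩
  1                                             ∎
  where open ≡-Reasoning

upTo-misses : ∀ {L a} → L ≤ a → ∑[ j ∈ upTo L ] 𝟙 (a ≡ᵇ j) ≡ 0
upTo-misses {L} {a} L≤a = trans (∑-cong-∈ (upTo L) miss) (∑-zero (upTo L))
  where
  miss : ∀ {j} → j ∈ upTo L → 𝟙 (a ≡ᵇ j) ≡ 0
  miss j∈ = 𝟙-≡ᵇ-≢ (<⇒≢ (<-≤-trans (∈-upTo⁻ j∈) L≤a) ∘ sym)

upTo-counts : ∀ {L a} → a < L → ∑[ j ∈ upTo L ] 𝟙 (a ≡ᵇ j) ≡ 1
upTo-counts {suc L} {a} a<1+L = begin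
  ∑[ j ∈ upTo (suc L) ] 𝟙 (a ≡ᵇ j)                   ≡⟨ cong (λ js → ∑[ j ∈ js ] 𝟙 (a ≡ᵇ j)) (sym (upTo-∷ʳ L)) ⟩
  ∑[ j ∈ upTo L ++ L ∷ [] ] 𝟙 (a ≡ᵇ j)               ≡⟨ ∑-++ (upTo L) (L ∷ []) (λ j → 𝟙 (a ≡ᵇ j)) ⟩
  ∑[ j ∈ upTo L ] 𝟙 (a ≡ᵇ j) + (𝟙 (a ≡ᵇ L) + 0)     ≡⟨ split (a <? L) ⟩
  1                                                 ∎
  where
  open ≡-Reasoning
  split : Dec (a < L) → ∑[ j ∈ upTo L ] 𝟙 (a ≡ᵇ j) + (𝟙 (a ≡ᵇ L) + 0) ≡ 1
  split (yes a<L) rewrite 𝟙-≡ᵇ-≢ (<⇒≢ a<L) = trans (+-identityʳ _) (upTo-counts a<L)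
  split (no  a≮L) with refl ← ≤-antisym (≤-pred a<1+L) (≮⇒≥ a≮L)
    rewrite upTo-misses {a} ≤-refl | 𝟙-≡ᵇ-refl a = refl

∑-upTo-select : ∀ {L a} → a < L → (h : ℕ → ℕ) → ∑[ j ∈ upTo L ] (𝟙 (a ≡ᵇ j) * h j) ≡ h a
∑-upTo-select {L} {a} a<L h = ∑-select (upTo L) (a ≡ᵇ_) h (λ j a≡j → cong h (sym (≡ᵇ⇒≡ a j a≡j))) (upTo-counts a<L)

infix 4 _≗?_

_≗?_ : ∀ {k n} (f g : Fin k → Fin n) → Dec (f ≗ g)
f ≗? g = all? (λ x → f x ≟ g x)

≗-decSetoid : ℕ → ℕ → DecSetoid 0ℓ 0ℓ
≗-decSetoid k n = record
  { Carrier          = Fin k → Fin n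
  ; _≈_              = _≗_
  ; isDecEquivalence = record
    { isEquivalence = record
      { refl  = λ _ → refl
      ; sym   = λ f≗g x → sym (f≗g x)
      ; trans = λ f≗g g≗h x → trans (f≗g x) (g≗h x)
      }
    ; _≟_ = _≗?_
    }
  }

funs-enumerates : ∀ k n → Enumerates (≗-decSetoid k n) (funs k n)
funs-enumerates zero    n h = refl
funs-enumerates (suc k) n h = begin
  ∑ (concatMap (λ i → map (cons i) (funs k n)) (allFin n)) (λ f → 𝟙 ⌊ f ≗? h ⌋)
    ≡⟨ ∑-concatMap (allFin n) (λ i → map (cons i) (funs k n)) (λ f → 𝟙 ⌊ f ≗? h ⌋) ⟩
  ∑[ i ∈ allFin n ] ∑ (map (cons i) (funs k n)) (λ f → 𝟙 ⌊ f ≗? h ⌋)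
    ≡⟨ ∑-cong (allFin n) (λ i → trans (∑-map (funs k n) (cons i) (λ f → 𝟙 ⌊ f ≗? h ⌋)) (∑-cong (funs k n) (cons-≗? i))) ⟩
  ∑[ i ∈ allFin n ] ∑[ g ∈ funs k n ] (𝟙 ⌊ i ≟ h zero ⌋ * 𝟙 ⌊ g ≗? h ∘ suc ⌋)
    ≡⟨ ∑-cong (allFin n) (λ i → *-distribˡ-∑ (funs k n) (𝟙 ⌊ i ≟ h zero ⌋) (λ g → 𝟙 ⌊ g ≗? h ∘ suc ⌋)) ⟩
  ∑[ i ∈ allFin n ] (𝟙 ⌊ i ≟ h zero ⌋ * ∑[ g ∈ funs k n ] 𝟙 ⌊ g ≗? h ∘ suc ⌋)
    ≡⟨ ∑-cong (allFin n) (λ i → trans (cong (𝟙 ⌊ i ≟ h zero ⌋ *_) (funs-enumerates k n (h ∘ suc))) (*-identityʳ _)) ⟩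
  ∑[ i ∈ allFin n ] 𝟙 ⌊ i ≟ h zero ⌋
    ≡⟨ allFin-enumerates n (h zero) ⟩
  1 ∎
  where
  open ≡-Reasoning
  cons-≗? : ∀ i g → 𝟙 ⌊ cons i g ≗? h ⌋ ≡ 𝟙 ⌊ i ≟ h zero ⌋ * 𝟙 ⌊ g ≗? h ∘ suc ⌋
  cons-≗? i g = trans (cong 𝟙 (⌊⌋-⇔ (mk⇔ split join) (cons i g ≗? h) ((i ≟ h zero) ×-dec (g ≗? h ∘ suc))))
                      (𝟙-×-dec (i ≟ h zero) (g ≗? h ∘ suc))
    where
    split : cons i g ≗ h → i ≡ h zero × g ≗ h ∘ suc
    split eq = eq zero , eq ∘ suc
    join : i ≡ h zero × g ≗ h ∘ suc → cons i g ≗ h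
    join (eq₀ , eqₛ) zero    = eq₀
    join (eq₀ , eqₛ) (suc x) = eqₛ x

module _ (S T : DecSetoid 0ℓ 0ℓ) where
  open DecSetoid S using () renaming (Carrier to A; _≈_ to _≈ᴬ_; _≟_ to _≟ᴬ_; sym to symᴬ; trans to transᴬ)
  open DecSetoid T using () renaming (Carrier to B; _≈_ to _≈ᴮ_; _≟_ to _≟ᴮ_)
  open ≡-Reasoning

  ×-enumerates : ∀ xs ys → Enumerates S xs → Enumerates T ys →
                 Enumerates (×-decSetoid S T) (cartesianProduct xs ys)
  ×-enumerates xs ys enumˣ enumʸ (a , b) = begin
    ∑ (cartesianProduct xs ys) _
      ≡⟨ ∑-cartesianProduct xs ys _ ⟩
    ∑[ x ∈ xs ] ∑[ y ∈ ys ] 𝟙 ⌊ (x ≟ᴬ a) ×-dec (y ≟ᴮ b) ⌋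
      ≡⟨ ∑-cong xs (λ x → trans (∑-cong ys (λ y → 𝟙-×-dec (x ≟ᴬ a) (y ≟ᴮ b)))
                                (*-distribˡ-∑ ys (𝟙 ⌊ x ≟ᴬ a ⌋) (λ y → 𝟙 ⌊ y ≟ᴮ b ⌋))) ⟩
    ∑[ x ∈ xs ] (𝟙 ⌊ x ≟ᴬ a ⌋ * ∑[ y ∈ ys ] 𝟙 ⌊ y ≟ᴮ b ⌋)
      ≡⟨ ∑-cong xs (λ x → trans (cong (𝟙 ⌊ x ≟ᴬ a ⌋ *_) (enumʸ b)) (*-identityʳ _)) ⟩
    ∑[ x ∈ xs ] 𝟙 ⌊ x ≟ᴬ a ⌋
      ≡⟨ enumˣ a ⟩
    1 ∎

  -- Double counting of the pairs (a , b) with a ≈ ψ b.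
  ∑-reindex : ∀ xs ys → Enumerates S xs → Enumerates T ys →
              (ψ : B → A) → (∀ {b b′} → b ≈ᴮ b′ → ψ b ≈ᴬ ψ b′) →
              (∀ {b b′} → ψ b ≈ᴬ ψ b′ → b ≈ᴮ b′) →
              (W : A → ℕ) → (∀ {a a′} → a ≈ᴬ a′ → W a ≡ W a′) → (∀ a → W a ≡ 0 ⊎ ∃ λ b → a ≈ᴬ ψ b) →
              ∑ xs W ≡ ∑ ys (W ∘ ψ)
  ∑-reindex xs ys enumˣ enumʸ ψ ψ-cong ψ-injective W W-cong support = begin
    ∑[ a ∈ xs ] W a                          ≡⟨ ∑-cong xs fibre ⟩
    ∑[ a ∈ xs ] ∑[ b ∈ ys ] (E a b * W a)    ≡⟨ ∑-comm xs ys (λ a b → E a b * W a) ⟩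
    ∑[ b ∈ ys ] ∑[ a ∈ xs ] (E a b * W a)    ≡⟨ ∑-cong ys (λ b → enumeration-select S xs enumˣ W W-cong (ψ b)) ⟩
    ∑[ b ∈ ys ] W (ψ b)                      ∎
    where
    E : A → B → ℕ
    E a b = 𝟙 ⌊ a ≟ᴬ ψ b ⌋
    fibre : ∀ a → W a ≡ ∑[ b ∈ ys ] (E a b * W a)
    fibre a with support a
    ... | inj₁ W≡0 rewrite W≡0 = sym (trans (∑-cong ys (λ b → *-zeroʳ (E a b))) (∑-zero ys))
    ... | inj₂ (b₀ , a≈ψb₀) = sym (begin
      ∑[ b ∈ ys ] (E a b * W a)  ≡⟨ *-distribʳ-∑ ys (W a) (E a) ⟩
      ∑ ys (E a) * W a           ≡⟨ cong (_* W a) (trans (∑-cong ys (λ b → cong 𝟙 (⌊⌋-⇔ (same b) (a ≟ᴬ ψ b) (b ≟ᴮ b₀))))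
                                                         (enumʸ b₀)) ⟩
      1 * W a                    ≡⟨ *-identityˡ (W a) ⟩
      W a                        ∎)
      where
      same : ∀ b → a ≈ᴬ ψ b ⇔ b ≈ᴮ b₀
      same b = mk⇔ (λ a≈ψb → ψ-injective (transᴬ (symᴬ a≈ψb) a≈ψb₀))
                   (λ b≈b₀ → transᴬ a≈ψb₀ (symᴬ (ψ-cong b≈b₀)))

module _ {n} (f : Fin n → Fin n) (v : Fin n) where

  DistinctIterates : ℕ → Set
  DistinctIterates t = ∀ i j → i < j → j < t → iter f i v ≢ iter f j v

  Returns : ℕ → Set
  Returns t = ∃ λ j → j < t × iter f t v ≡ iter f j v

  returns⇒revisits : ∀ {t} → Returns t → T (revisits f v t)
  returns⇒revisits {t} (j , j<t , eq) = any⁺ _ (lose (∈-upTo⁺ j<t) (fromWitness eq))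

  revisits⇒returns : ∀ {t} → T (revisits f v t) → Returns t
  revisits⇒returns {t} r with j , j∈ , eq ← find (any⁻ _ (upTo t) r) = j , ∈-upTo⁻ j∈ , toWitness eq

  distinctIterates⇒≤ : ∀ {t} → DistinctIterates t → t ≤ n
  distinctIterates⇒≤ {t} distinct = injective⇒≤ {f = λ (x : Fin t) → iter f (toℕ x) v} injective
    where
    injective : Injective _≡_ _≡_ (λ (x : Fin t) → iter f (toℕ x) v)
    injective {x} {y} eq with <-cmp (toℕ x) (toℕ y)
    ... | tri< x<y _ _ = ⊥-elim (distinct (toℕ x) (toℕ y) x<y (toℕ<n y) eq)
    ... | tri≈ _ x≡y _ = toℕ-injective x≡y
    ... | tri> _ _ y<x = ⊥-elim (distinct (toℕ y) (toℕ x) y<x (toℕ<n x) (sym eq))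

  search-finds : ∀ fuel {k t} → k ≤ t → t < k + fuel → T (revisits f v t) →
                 (∀ {t′} → k ≤ t′ → t′ < t → ¬ T (revisits f v t′)) → search f v k fuel ≡ t
  search-finds zero       {k} k≤t t<k+0 _ _ = ⊥-elim (<⇒≱ t<k+0 (subst (_≤ _) (sym (+-identityʳ k)) k≤t))
  search-finds (suc fuel) {k} {t} k≤t t<k+fuel returns-t before with k ≟ℕ t | revisits f v k in revisits-k
  ... | yes refl | true  = refl
  ... | yes refl | false = ⊥-elim (subst T revisits-k returns-t)
  ... | no k≢t   | true  = ⊥-elim (before ≤-refl (≤∧≢⇒< k≤t k≢t) (subst T (sym revisits-k) tt))
  ... | no k≢t   | false = search-finds fuel (≤∧≢⇒< k≤t k≢t) (subst (t <_) (+-suc k fuel) t<k+fuel) returns-t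
                             (before ∘ <⇒≤)

  sixLen-unique : ∀ {t} → DistinctIterates t → Returns t → sixLen f v ≡ t
  sixLen-unique {t} distinct returns@(j , j<t , _) =
    search-finds n (≤-trans (s≤s z≤n) j<t) (s≤s (distinctIterates⇒≤ distinct)) (returns⇒revisits returns) no-return
    where
    no-return : ∀ {t′} → 1 ≤ t′ → t′ < t → ¬ T (revisits f v t′)
    no-return _ t′<t r with j′ , j′<t′ , eq ← revisits⇒returns r = distinct j′ _ j′<t′ t′<t (sym eq)

  first-return : ∀ t → DistinctIterates (suc t) ⊎ ∃ λ s → DistinctIterates s × Returns s
  first-return zero = inj₁ λ i j i<j j<1 → ⊥-elim (<⇒≱ (<-≤-trans i<j (≤-pred j<1)) z≤n)
  first-return (suc t) with first-return t
  ... | inj₂ found = inj₂ found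
  ... | inj₁ distinct with revisits f v (suc t) in revisits≡
  ... | true  = inj₂ (suc t , distinct , revisits⇒returns (subst T (sym revisits≡) tt))
  ... | false = inj₁ distinct′
    where
    distinct′ : DistinctIterates (suc (suc t))
    distinct′ i j i<j j<2+t with m≤n⇒m<n∨m≡n (≤-pred j<2+t)
    ... | inj₁ j<1+t = distinct i j i<j j<1+t
    ... | inj₂ refl  = λ iter-eq → subst T revisits≡ (returns⇒revisits (i , i<j , sym iter-eq))

  sixLen-spec : DistinctIterates (sixLen f v) × Returns (sixLen f v)
  sixLen-spec with first-return n
  ... | inj₁ distinct = ⊥-elim (<-irrefl refl (distinctIterates⇒≤ distinct))
  ... | inj₂ (s , distinct , returns) rewrite sixLen-unique distinct returns = distinct , returns

  sixLen≤n : sixLen f v ≤ n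
  sixLen≤n = distinctIterates⇒≤ (proj₁ sixLen-spec)

iter-cong : ∀ {n} {f g : Fin n → Fin n} → f ≗ g → ∀ k v → iter f k v ≡ iter g k v
iter-cong         f≗g zero    v = refl
iter-cong {g = g} f≗g (suc k) v = trans (f≗g _) (cong g (iter-cong f≗g k v))

sixLen-cong : ∀ {n} {f g : Fin n → Fin n} → f ≗ g → ∀ v → sixLen f v ≡ sixLen g v
sixLen-cong {f = f} {g} f≗g v with distinct , (j , j<s , eq) ← sixLen-spec f v =
  sym (sixLen-unique g v (λ i k i<k k<s eq′ → distinct i k i<k k<s (trans (≡-iter i) (trans eq′ (sym (≡-iter k)))))
                         (j , j<s , trans (sym (≡-iter (sixLen f v))) (trans eq (≡-iter j))))
  where
  ≡-iter : ∀ k → iter f k v ≡ iter g k v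
  ≡-iter k = iter-cong f≗g k v

indeg≡∑ : ∀ {n} (f : Fin n → Fin n) v → indeg f v ≡ ∑[ x ∈ allFin n ] 𝟙 (f x == v)
indeg≡∑ {n} f v = countᵇ≡∑ (λ x → f x == v) (allFin n)

indeg-cong : ∀ {n} {f g : Fin n → Fin n} → f ≗ g → ∀ v → indeg f v ≡ indeg g v
indeg-cong {n} {f} {g} f≗g v = begin
  indeg f v                         ≡⟨ indeg≡∑ f v ⟩
  ∑[ x ∈ allFin n ] 𝟙 (f x == v)    ≡⟨ ∑-cong (allFin n) (λ x → cong (λ y → 𝟙 (y == v)) (f≗g x)) ⟩
  ∑[ x ∈ allFin n ] 𝟙 (g x == v)    ≡⟨ sym (indeg≡∑ g v) ⟩
  indeg g v                         ∎
  where open ≡-Reasoning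

module _ {n} (d : Fin n → ℕ) (f : Fin n → Fin n) where

  hasDegSeq-sound : T (hasDegSeq d f) → ∀ v → indeg f v ≡ d v
  hasDegSeq-sound h v = ≡ᵇ⇒≡ _ _ (tabulate⁻ (all⁺ (λ v → indeg f v ≡ᵇ d v) (allFin n) h) v)

  hasDegSeq-complete : (∀ v → indeg f v ≡ d v) → T (hasDegSeq d f)
  hasDegSeq-complete degrees = all⁻ _ (tabulate⁺ (λ v → ≡⇒≡ᵇ _ _ (degrees v)))

hasDegSeq-cong : ∀ {n} (d : Fin n → ℕ) {f g : Fin n → Fin n} → f ≗ g → hasDegSeq d f ≡ hasDegSeq d g
hasDegSeq-cong d {f} {g} f≗g = T-⇔⇒≡
  (λ h → hasDegSeq-complete d g (λ v → trans (sym (indeg-cong f≗g v)) (hasDegSeq-sound d f h v)))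
  (λ h → hasDegSeq-complete d f (λ v → trans (indeg-cong f≗g v) (hasDegSeq-sound d g h v)))

indeg≡1⇒unique-preimage : ∀ {n} (f : Fin n → Fin n) v → indeg f v ≡ 1 →
                          ∃ λ p → f p ≡ v × (∀ x → f x ≡ v → x ≡ p)
indeg≡1⇒unique-preimage {n} f v indeg≡1 with any? (λ x → f x ≟ v)
... | no none = ⊥-elim (0≢1+n (trans (sym (∑-zero (allFin n))) (trans (∑-cong (allFin n) zero-term) count≡1)))
  where
  count≡1 : ∑[ x ∈ allFin n ] 𝟙 (f x == v) ≡ 1
  count≡1 = trans (sym (indeg≡∑ f v)) indeg≡1
  zero-term : ∀ x → 0 ≡ 𝟙 (f x == v)
  zero-term x = sym (cong 𝟙 (==-≢ (λ fx≡v → none (x , fx≡v))))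
... | yes (p , fp≡v) = p , fp≡v , unique
  where
  unique : ∀ x → f x ≡ v → x ≡ p
  unique x fx≡v with x ≟ p
  ... | yes x≡p = x≡p
  ... | no x≢p = ⊥-elim (<⇒≱ (s≤s (s≤s z≤n)) (subst (2 ≤_) (trans (sym (indeg≡∑ f v)) indeg≡1) two≤))
    where
    ≤-term : ∀ y → 𝟙 (y == x) + 𝟙 (y == p) ≤ 𝟙 (f y == v)
    ≤-term y with y ≟ x | y ≟ p
    ... | yes refl | yes refl = ⊥-elim (x≢p refl)
    ... | yes refl | no _     = ≤-reflexive (cong 𝟙 (sym (trans (cong (_== v) fx≡v) (==-refl v))))
    ... | no _     | yes refl = ≤-reflexive (cong 𝟙 (sym (trans (cong (_== v) fp≡v) (==-refl v))))
    ... | no _     | no _     = z≤n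
    two≤ : 2 ≤ ∑[ y ∈ allFin n ] 𝟙 (f y == v)
    two≤ = subst (_≤ ∑[ y ∈ allFin n ] 𝟙 (f y == v))
                 (trans (∑-distrib-+ (allFin n) (λ y → 𝟙 (y == x)) (λ y → 𝟙 (y == p)))
                        (cong₂ _+_ (allFin-enumerates n x) (allFin-enumerates n p)))
                 (∑-mono-≤ (allFin n) ≤-term)

FGCount≡∑ : ∀ n d → FGCount n d ≡ ∑[ f ∈ funs n n ] 𝟙 (hasDegSeq d f)
FGCount≡∑ n d = countᵇ≡∑ (hasDegSeq d) (funs n n)

SixLenCount≡∑ : ∀ n d w k → SixLenCount n d w k ≡ ∑[ f ∈ funs n n ] (𝟙 (hasDegSeq d f) * 𝟙 (sixLen f w ≡ᵇ k))
SixLenCount≡∑ n d w k = countᵇ-filterᵇ (hasDegSeq d) (λ f → sixLen f w ≡ᵇ k) (funs n n)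

-- The Pólya urn

urnDen-suc : ∀ m t → urnDen (suc m) t ≡ urnDen m t * (t + m)
urnDen-suc zero    t = trans (*-identityʳ t) (sym (trans (+-identityʳ (t + 0)) (+-identityʳ t)))
urnDen-suc (suc m) t = begin
  t * urnDen (suc m) (suc t)            ≡⟨ cong (t *_) (urnDen-suc m (suc t)) ⟩
  t * (urnDen m (suc t) * (suc t + m))  ≡⟨ sym (*-assoc t _ _) ⟩
  t * urnDen m (suc t) * (suc t + m)    ≡⟨ cong (t * urnDen m (suc t) *_) (sym (+-suc t m)) ⟩
  t * urnDen m (suc t) * (t + suc m)    ∎
  where open ≡-Reasoning

-- urnNum conditions on the first draw; this is the decomposition by the last one, drawn from t = a + b + m balls.
urnNum-suc : ∀ m a b k {t L} → a + b + m ≡ t → a + m < L →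
             ∑[ j ∈ upTo L ] (urnNum m a b j * urnNum 1 j (t ∸ j) k) ≡ urnNum (suc m) a b k
urnNum-suc zero a b k {t} {L} refl a+0<L = begin
  ∑[ j ∈ upTo L ] (urnNum 0 a b j * urnNum 1 j (a + b + 0 ∸ j) k)
    ≡⟨ ∑-upTo-select (subst (_< L) (+-identityʳ a) a+0<L) _ ⟩
  urnNum 1 a (a + b + 0 ∸ a) k
    ≡⟨ cong (λ b′ → urnNum 1 a b′ k) (trans (cong (_∸ a) (+-identityʳ (a + b))) (m+n∸m≡n a b)) ⟩
  urnNum 1 a b k
    ∎
  where open ≡-Reasoning
urnNum-suc (suc m) a b k {t} {L} balls a+1+m<L = begin
  ∑[ j ∈ upTo L ] ((a * R j + b * B j) * U j)
    ≡⟨ ∑-cong (upTo L) (λ j → trans (*-distribʳ-+ (U j) (a * R j) (b * B j))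
                                    (cong₂ _+_ (*-assoc a (R j) (U j)) (*-assoc b (B j) (U j)))) ⟩
  ∑[ j ∈ upTo L ] (a * (R j * U j) + b * (B j * U j))
    ≡⟨ ∑-distrib-+ (upTo L) (λ j → a * (R j * U j)) (λ j → b * (B j * U j)) ⟩
  ∑[ j ∈ upTo L ] (a * (R j * U j)) + ∑[ j ∈ upTo L ] (b * (B j * U j))
    ≡⟨ cong₂ _+_ (*-distribˡ-∑ (upTo L) a (λ j → R j * U j)) (*-distribˡ-∑ (upTo L) b (λ j → B j * U j)) ⟩
  a * ∑[ j ∈ upTo L ] (R j * U j) + b * ∑[ j ∈ upTo L ] (B j * U j)
    ≡⟨ cong₂ (λ r b′ → a * r + b * b′)
             (urnNum-suc m (suc a) b k (trans (sym (+-suc (a + b) m)) balls) (subst (_< L) (+-suc a m) a+1+m<L))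
             (urnNum-suc m a (suc b) k (trans (cong (_+ m) (+-suc a b)) (trans (sym (+-suc (a + b) m)) balls))
                         (<-trans (n<1+n (a + m)) (subst (_< L) (+-suc a m) a+1+m<L))) ⟩
  a * urnNum (suc m) (suc a) b k + b * urnNum (suc m) a (suc b) k ∎
  where
  open ≡-Reasoning
  R B U : ℕ → ℕ
  R j = urnNum m (suc a) b j
  B j = urnNum m a (suc b) j
  U j = urnNum 1 j (t ∸ j) k

injective-missing⇒< : ∀ {m n} {f : Fin m → Fin n} → Injective _≡_ _≡_ f → ∀ t → (∀ x → f x ≢ t) → m < n
injective-missing⇒< {n = suc n} {f} f-injective t missing =
  s≤s (injective⇒≤ {f = λ x → punchOut (missing x ∘ sym)}
                    (λ eq → f-injective (punchOut-injective (missing _ ∘ sym) (missing _ ∘ sym) eq)))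

injective-<⇒missing : ∀ {m n} {f : Fin m → Fin n} → Injective _≡_ _≡_ f → m < n → ∃ λ t → ∀ x → f x ≢ t
injective-<⇒missing {m} {n} {f} f-injective m<n =
  let t , not-hit = ¬∀⟶∃¬ n (λ t → ∃ λ x → f x ≡ t) (λ t → any? (λ x → f x ≟ t)) all-hit
  in  t , λ x fx≡t → not-hit (x , fx≡t)
  where
  all-hit : ¬ (∀ t → ∃ λ x → f x ≡ t)
  all-hit hit = <⇒≱ m<n (injective⇒≤ {f = proj₁ ∘ hit} λ {t} {t′} eq →
                  trans (sym (proj₂ (hit t))) (trans (cong f eq) (proj₂ (hit t′))))

record Complement {N} (u : Fin (suc N)) : Set where
  field
    embed         : Fin N → Fin (suc N)
    retract       : Fin (suc N) → Fin N
    embed≢u       : ∀ x → embed x ≢ u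
    retract-embed : ∀ x → retract (embed x) ≡ x
    embed-retract : ∀ {v} → v ≢ u → embed (retract v) ≡ v

  embed-injective : Injective _≡_ _≡_ embed
  embed-injective {x} {y} eq = trans (sym (retract-embed x)) (trans (cong retract eq) (retract-embed y))

  retract∘-injective : ∀ {m} {e : Fin m → Fin (suc N)} → (∀ x → e x ≢ u) → Injective _≡_ _≡_ e →
                       Injective _≡_ _≡_ (retract ∘ e)
  retract∘-injective e≢u e-injective {x} {y} eq =
    e-injective (trans (sym (embed-retract (e≢u x))) (trans (cong embed eq) (embed-retract (e≢u y))))

-- The default point is the junk value of the retraction at u.
complement : ∀ {N} {u : Fin (suc N)} (e : Fin N → Fin (suc N)) → Injective _≡_ _≡_ e → (∀ x → e x ≢ u) →
             Fin N → Complement u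
complement {N} {u} e e-injective e≢u default = record
  { embed         = e
  ; retract       = λ v → preimage v (any? (λ x → e x ≟ v))
  ; embed≢u       = e≢u
  ; retract-embed = λ x → retract-embed x (any? (λ y → e y ≟ e x))
  ; embed-retract = λ {v} v≢u → embed-retract v v≢u (any? (λ x → e x ≟ v))
  }
  where
  preimage : ∀ v → Dec (∃ λ x → e x ≡ v) → Fin N
  preimage v (yes (x , _)) = x
  preimage v (no _)        = default
  retract-embed : ∀ x hit? → preimage (e x) hit? ≡ x
  retract-embed x (yes (y , ey≡ex)) = e-injective ey≡ex
  retract-embed x (no missed)       = ⊥-elim (missed (x , refl))
  embed-retract : ∀ v → v ≢ u → ∀ hit? → e (preimage v hit?) ≡ v
  embed-retract v v≢u (yes (x , ex≡v)) = ex≡v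
  embed-retract v v≢u (no missed) = ⊥-elim (<-irrefl refl (injective-missing⇒< {f = λ x → punchOut (e≢u x ∘ sym)}
    (λ eq → e-injective (punchOut-injective (e≢u _ ∘ sym) (e≢u _ ∘ sym) eq))
    (punchOut (v≢u ∘ sym))
    (λ x eq → missed (x , punchOut-injective (e≢u x ∘ sym) (v≢u ∘ sym) eq))))

-- Inserting a vertex of in-degree one

module Insertion {N} {u : Fin (suc N)} (c : Complement u) where
  open Complement c
  open ≡-Reasoning

  -- insert g p routes the edge leaving p through the new vertex u: p ↦ u ↦ (old image of p).
  -- For p = u this makes u a fixed point.
  insert : (Fin N → Fin N) → Fin (suc N) → Fin (suc N) → Fin (suc N)
  insert g p v = if v == p then u else if v == u then embed (g (retract p)) else embed (g (retract v))

  module _ (g : Fin N → Fin N) (p : Fin (suc N)) where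

    insert-p : insert g p p ≡ u
    insert-p rewrite ==-refl p = refl

    insert-u : p ≢ u → insert g p u ≡ embed (g (retract p))
    insert-u p≢u rewrite ==-≢ (p≢u ∘ sym) | ==-refl u = refl

    insert-other : ∀ {v} → v ≢ p → v ≢ u → insert g p v ≡ embed (g (retract v))
    insert-other v≢p v≢u rewrite ==-≢ v≢p | ==-≢ v≢u = refl

    insert-embed : ∀ {x} → embed x ≢ p → insert g p (embed x) ≡ embed (g x)
    insert-embed {x} ex≢p = trans (insert-other ex≢p (embed≢u x)) (cong (embed ∘ g) (retract-embed x))

    insert≢u : ∀ {v} → v ≢ p → insert g p v ≢ u
    insert≢u {v} v≢p = by-cases (v ≟ u)
      where
      by-cases : Dec (v ≡ u) → insert g p v ≢ u
      by-cases (yes refl) = embed≢u _ ∘ trans (sym (insert-u (v≢p ∘ sym)))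
      by-cases (no v≢u)   = embed≢u _ ∘ trans (sym (insert-other v≢p v≢u))

    insert≡u⇔ : ∀ v → insert g p v ≡ u ⇔ v ≡ p
    insert≡u⇔ v = mk⇔ (λ eq → decidable-stable (v ≟ p) (λ v≢p → insert≢u v≢p eq)) (λ { refl → insert-p })

  insert-cong : ∀ {g g′ p} → g ≗ g′ → insert g p ≗ insert g′ p
  insert-cong {g} {g′} {p} g≗g′ v with v == p | v == u
  ... | true  | _     = refl
  ... | false | true  = cong embed (g≗g′ (retract p))
  ... | false | false = cong embed (g≗g′ (retract v))

  ==-embed : ∀ v x → v ≢ u → (v == embed x) ≡ (x == retract v)
  ==-embed v x v≢u = ⌊⌋-⇔ (mk⇔ (λ eq → trans (sym (retract-embed x)) (cong retract (sym eq)))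
                              (λ eq → trans (sym (embed-retract v≢u)) (cong embed (sym eq))))
                         (v ≟ embed x) (x ≟ retract v)

  ∑-complement : (h : Fin (suc N) → ℕ) → ∑ (allFin (suc N)) h ≡ h u + ∑[ x ∈ allFin N ] h (embed x)
  ∑-complement h = begin
    ∑[ v ∈ allFin (suc N) ] h v
      ≡⟨ ∑-cong (allFin (suc N)) (λ v → sym (trans (cong (_* h v) (cover v)) (+-identityʳ (h v)))) ⟩
    ∑[ v ∈ allFin (suc N) ] ((𝟙 (v == u) + ∑[ x ∈ allFin N ] 𝟙 (v == embed x)) * h v)
      ≡⟨ ∑-cong (allFin (suc N)) (λ v → trans (*-distribʳ-+ (h v) (𝟙 (v == u)) _)
           (cong (𝟙 (v == u) * h v +_) (sym (*-distribʳ-∑ (allFin N) (h v) (λ x → 𝟙 (v == embed x)))))) ⟩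
    ∑[ v ∈ allFin (suc N) ] (𝟙 (v == u) * h v + ∑[ x ∈ allFin N ] (𝟙 (v == embed x) * h v))
      ≡⟨ ∑-distrib-+ (allFin (suc N)) (λ v → 𝟙 (v == u) * h v) (λ v → ∑[ x ∈ allFin N ] (𝟙 (v == embed x) * h v)) ⟩
    ∑[ v ∈ allFin (suc N) ] (𝟙 (v == u) * h v) + ∑[ v ∈ allFin (suc N) ] ∑[ x ∈ allFin N ] (𝟙 (v == embed x) * h v)
      ≡⟨ cong₂ _+_ (select u) (∑-comm (allFin (suc N)) (allFin N) (λ v x → 𝟙 (v == embed x) * h v)) ⟩
    h u + ∑[ x ∈ allFin N ] ∑[ v ∈ allFin (suc N) ] (𝟙 (v == embed x) * h v)
      ≡⟨ cong (h u +_) (∑-cong (allFin N) (select ∘ embed)) ⟩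
    h u + ∑[ x ∈ allFin N ] h (embed x) ∎
    where
    select : ∀ a → ∑[ v ∈ allFin (suc N) ] (𝟙 (v == a) * h v) ≡ h a
    select = enumeration-select (Fin-decSetoid (suc N)) (allFin (suc N)) (allFin-enumerates (suc N)) h (cong h)
    cover : ∀ v → 𝟙 (v == u) + ∑[ x ∈ allFin N ] 𝟙 (v == embed x) ≡ 1
    cover v with v ≟ u
    ... | yes refl = cong suc (trans (∑-cong (allFin N) (λ x → cong 𝟙 (==-≢ (embed≢u x ∘ sym)))) (∑-zero (allFin N)))
    ... | no v≢u   = trans (∑-cong (allFin N) (λ x → cong 𝟙 (==-embed v x v≢u))) (allFin-enumerates N (retract v))

  indeg-insert-u : ∀ g p → indeg (insert g p) u ≡ 1
  indeg-insert-u g p = begin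
    indeg (insert g p) u                       ≡⟨ indeg≡∑ (insert g p) u ⟩
    ∑[ v ∈ allFin (suc N) ] 𝟙 (insert g p v == u)
      ≡⟨ ∑-cong (allFin (suc N)) (λ v → cong 𝟙 (⌊⌋-⇔ (insert≡u⇔ g p v) (insert g p v ≟ u) (v ≟ p))) ⟩
    ∑[ v ∈ allFin (suc N) ] 𝟙 (v == p)         ≡⟨ allFin-enumerates (suc N) p ⟩
    1                                          ∎

  embed-== : ∀ a b → (embed a == embed b) ≡ (a == b)
  embed-== a b = ⌊⌋-⇔ (mk⇔ embed-injective (cong embed)) (embed a ≟ embed b) (a ≟ b)

  indeg-insert-embed : ∀ g p z → indeg (insert g p) (embed z) ≡ indeg g z
  indeg-insert-embed g p z = begin
    indeg (insert g p) (embed z)                               ≡⟨ indeg≡∑ (insert g p) (embed z) ⟩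
    ∑[ v ∈ allFin (suc N) ] H v                                ≡⟨ ∑-complement H ⟩
    H u + ∑[ x ∈ allFin N ] H (embed x)                        ≡⟨ by-cases (p ≟ u) ⟩
    ∑[ x ∈ allFin N ] G x                                      ≡⟨ sym (indeg≡∑ g z) ⟩
    indeg g z                                                  ∎
    where
    H : Fin (suc N) → ℕ
    H v = 𝟙 (insert g p v == embed z)
    G : Fin N → ℕ
    G x = 𝟙 (g x == z)
    H-embed : ∀ {x} → embed x ≢ p → H (embed x) ≡ G x
    H-embed {x} ex≢p = cong 𝟙 (trans (cong (_== embed z) (insert-embed g p ex≢p)) (embed-== (g x) z))
    by-cases : Dec (p ≡ u) → H u + ∑[ x ∈ allFin N ] H (embed x) ≡ ∑[ x ∈ allFin N ] G x
    by-cases (yes refl) = cong₂ _+_ (cong 𝟙 (trans (cong (_== embed z) (insert-p g u)) (==-≢ (embed≢u z ∘ sym))))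
                                    (∑-cong (allFin N) (λ x → H-embed (embed≢u x)))
    by-cases (no p≢u) = begin
      H u + ∑[ x ∈ allFin N ] H (embed x)
        ≡⟨ cong₂ _+_ (cong 𝟙 (trans (cong (_== embed z) (insert-u g p p≢u)) (embed-== (g q) z))) (∑-cong (allFin N) H-embed′) ⟩
      G q + ∑[ x ∈ allFin N ] (𝟙 (not (x == q)) * G x)
        ≡⟨ sym (enumeration-split (Fin-decSetoid N) (allFin N) (allFin-enumerates N) G (cong G) q) ⟩
      ∑[ x ∈ allFin N ] G x ∎
      where
      q = retract p
      H-embed′ : ∀ x → H (embed x) ≡ 𝟙 (not (x == q)) * G x
      H-embed′ x with x ≟ q
      ... | yes refl = cong 𝟙 (begin
        insert g p (embed (retract p)) == embed z  ≡⟨ cong (λ v → insert g p v == embed z) (embed-retract p≢u) ⟩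
        insert g p p == embed z                    ≡⟨ cong (_== embed z) (insert-p g p) ⟩
        u == embed z                               ≡⟨ ==-≢ (embed≢u z ∘ sym) ⟩
        false                                      ∎)
      ... | no x≢q   = trans (H-embed (λ ex≡p → x≢q (trans (sym (retract-embed x)) (cong retract ex≡p)))) (sym (+-identityʳ (G x)))

  module _ (d : Fin (suc N) → ℕ) (d′ : Fin N → ℕ) (d-u : d u ≡ 1) (d-embed : ∀ x → d (embed x) ≡ d′ x) where

    hasDegSeq-insert : ∀ g p → hasDegSeq d (insert g p) ≡ hasDegSeq d′ g
    hasDegSeq-insert g p = T-⇔⇒≡
      (λ h → hasDegSeq-complete d′ g λ z →
        trans (sym (indeg-insert-embed g p z)) (trans (hasDegSeq-sound d (insert g p) h (embed z)) (d-embed z)))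
      (λ h → hasDegSeq-complete d (insert g p) (degrees h))
      where
      degrees : T (hasDegSeq d′ g) → ∀ v → indeg (insert g p) v ≡ d v
      degrees h v with v ≟ u
      ... | yes refl = trans (indeg-insert-u g p) (sym d-u)
      ... | no v≢u   = begin
        indeg (insert g p) v              ≡⟨ cong (indeg (insert g p)) (sym (embed-retract v≢u)) ⟩
        indeg (insert g p) (embed (retract v)) ≡⟨ indeg-insert-embed g p (retract v) ⟩
        indeg g (retract v)               ≡⟨ hasDegSeq-sound d′ g h (retract v) ⟩
        d′ (retract v)                    ≡⟨ sym (d-embed (retract v)) ⟩
        d (embed (retract v))             ≡⟨ cong d (embed-retract v≢u) ⟩
        d v                               ∎

    insert-surjective : ∀ f → T (hasDegSeq d f) → ∃ λ ((g , p) : (Fin N → Fin N) × Fin (suc N)) → f ≗ insert g p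
    insert-surjective f f-degrees = (g , p) , f≗insert
      where
      unique-preimage = indeg≡1⇒unique-preimage f u (trans (hasDegSeq-sound d f f-degrees u) d-u)
      p : Fin (suc N)
      p = proj₁ unique-preimage
      fp≡u : f p ≡ u
      fp≡u = proj₁ (proj₂ unique-preimage)
      f≢u : ∀ {v} → v ≢ p → f v ≢ u
      f≢u v≢p fv≡u = v≢p (proj₂ (proj₂ unique-preimage) _ fv≡u)
      reroute : Fin N → Fin (suc N)
      reroute x = if embed x == p then u else embed x
      g : Fin N → Fin N
      g = retract ∘ f ∘ reroute
      reroute-p : p ≢ u → reroute (retract p) ≡ u
      reroute-p p≢u rewrite embed-retract p≢u | ==-refl p = refl
      reroute-other : ∀ {v} → v ≢ p → v ≢ u → reroute (retract v) ≡ v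
      reroute-other v≢p v≢u rewrite embed-retract v≢u | ==-≢ v≢p = refl
      f≗insert : f ≗ insert g p
      f≗insert v = by-cases (v ≟ p) (v ≟ u)
        where
        by-cases : Dec (v ≡ p) → Dec (v ≡ u) → f v ≡ insert g p v
        by-cases (yes refl) _          = trans fp≡u (sym (insert-p g v))
        by-cases (no v≢p)   (yes refl) = begin
          f v                     ≡⟨ sym (embed-retract (f≢u v≢p)) ⟩
          embed (retract (f v))   ≡⟨ cong (embed ∘ retract ∘ f) (sym (reroute-p (v≢p ∘ sym))) ⟩
          embed (g (retract p))   ≡⟨ sym (insert-u g p (v≢p ∘ sym)) ⟩
          insert g p v            ∎
        by-cases (no v≢p)   (no v≢u)   = begin
          f v                     ≡⟨ sym (embed-retract (f≢u v≢p)) ⟩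
          embed (retract (f v))   ≡⟨ cong (embed ∘ retract ∘ f) (sym (reroute-other v≢p v≢u)) ⟩
          embed (g (retract v))   ≡⟨ sym (insert-other g p v≢p v≢u) ⟩
          insert g p v            ∎

  insert-injective : ∀ {g g′ p p′} → insert g p ≗ insert g′ p′ → g ≗ g′ × p ≡ p′
  insert-injective {g} {g′} {p} {p′} same = g≗g′ , p≡p′
    where
    p≡p′ : p ≡ p′
    p≡p′ = Equivalence.to (insert≡u⇔ g′ p′ p) (trans (sym (same p)) (insert-p g p))
    g≗g′ : g ≗ g′
    g≗g′ x with embed x ≟ p
    ... | no ex≢p = embed-injective (begin
      embed (g x)         ≡⟨ sym (insert-embed g p ex≢p) ⟩
      insert g p (embed x)   ≡⟨ same (embed x) ⟩
      insert g′ p′ (embed x) ≡⟨ insert-embed g′ p′ (ex≢p ∘ flip trans (sym p≡p′)) ⟩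
      embed (g′ x)        ∎)
    ... | yes ex≡p = embed-injective (begin
      embed (g x)            ≡⟨ cong (embed ∘ g) (trans (sym (retract-embed x)) (cong retract ex≡p)) ⟩
      embed (g (retract p))  ≡⟨ sym (insert-u g p p≢u) ⟩
      insert g p u           ≡⟨ same u ⟩
      insert g′ p′ u         ≡⟨ insert-u g′ p′ (p≢u ∘ trans p≡p′) ⟩
      embed (g′ (retract p′)) ≡⟨ cong (embed ∘ g′) (trans (cong retract (trans (sym p≡p′) (sym ex≡p))) (retract-embed x)) ⟩
      embed (g′ x)           ∎)
      where
      p≢u : p ≢ u
      p≢u = embed≢u x ∘ trans ex≡p

  module Orbit (g : Fin N → Fin N) (w : Fin N) where

    s : ℕ
    s = sixLen g w

    O : ℕ → Fin N
    O j = iter g j w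

    O-distinct : DistinctIterates g w s
    O-distinct = proj₁ (sixLen-spec g w)

    O-injective : ∀ {a b} → a < s → b < s → O a ≡ O b → a ≡ b
    O-injective {a} {b} a<s b<s eq with <-cmp a b
    ... | tri< a<b _ _ = ⊥-elim (O-distinct a b a<b b<s eq)
    ... | tri≈ _ a≡b _ = a≡b
    ... | tri> _ _ b<a = ⊥-elim (O-distinct b a b<a a<s (sym eq))

    F : Fin (suc N) → ℕ → Fin (suc N)
    F p t = iter (insert g p) t (embed w)

    F-follows : ∀ p {t a} → embed (O a) ≢ p → F p t ≡ embed (O a) → F p (suc t) ≡ embed (O (suc a))
    F-follows p ne eq = trans (cong (insert g p) eq) (insert-embed g p ne)

    module OffOrbit (p : Fin (suc N)) (off : ∀ {j} → j < s → embed (O j) ≢ p) where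

      F-off : ∀ t → t ≤ s → F p t ≡ embed (O t)
      F-off zero    _     = refl
      F-off (suc t) 1+t≤s = F-follows p {t} {t} (off 1+t≤s) (F-off t (<⇒≤ 1+t≤s))

      sixLen-insert : sixLen (insert g p) (embed w) ≡ s
      sixLen-insert with j , j<s , Os≡Oj ← proj₂ (sixLen-spec g w) =
        sixLen-unique (insert g p) (embed w)
          (λ a b a<b b<s eq → O-distinct a b a<b b<s
             (embed-injective (trans (sym (F-off a (<⇒≤ (<-trans a<b b<s)))) (trans eq (F-off b (<⇒≤ b<s))))))
          (j , j<s , trans (F-off s ≤-refl) (trans (cong embed Os≡Oj) (sym (F-off j (<⇒≤ j<s)))))

    -- After the insertion the orbit of embed w reads O 0, …, O i, u, O (i + 1), …, O s.
    module OnOrbit (p : Fin (suc N)) {i} (i<s : i < s) (p≡Oi : p ≡ embed (O i)) where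

      p≢u : p ≢ u
      p≢u = embed≢u (O i) ∘ trans (sym p≡Oi)

      O≢p : ∀ {t} → t < s → t ≢ i → embed (O t) ≢ p
      O≢p t<s t≢i eq = t≢i (O-injective t<s i<s (embed-injective (trans eq p≡Oi)))

      F-before : ∀ t → t ≤ i → F p t ≡ embed (O t)
      F-before zero    _     = refl
      F-before (suc t) 1+t≤i = F-follows p {t} {t} (O≢p (<-≤-trans 1+t≤i (<⇒≤ i<s)) (<⇒≢ 1+t≤i)) (F-before t (<⇒≤ 1+t≤i))

      F-at : F p (suc i) ≡ u
      F-at = trans (cong (insert g p) (trans (F-before i ≤-refl) (sym p≡Oi))) (insert-p g p)

      F-after : ∀ t → i < t → t ≤ s → F p (suc t) ≡ embed (O t)
      F-after (suc t) i<1+t 1+t≤s with m≤n⇒m<n∨m≡n (≤-pred i<1+t)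
      ... | inj₁ i<t  = F-follows p {suc t} {t} (O≢p 1+t≤s (<⇒≢ i<t ∘ sym)) (F-after t i<t (<⇒≤ 1+t≤s))
      ... | inj₂ refl = begin
        insert g p (F p (suc i))  ≡⟨ cong (insert g p) F-at ⟩
        insert g p u              ≡⟨ insert-u g p p≢u ⟩
        embed (g (retract p))     ≡⟨ cong (embed ∘ g) (trans (cong retract p≡Oi) (retract-embed (O i))) ⟩
        embed (O (suc i))         ∎

      data Position (t : ℕ) : Set where
        before : t ≤ i → Position t
        at     : t ≡ suc i → Position t
        after  : ∀ t′ → t ≡ suc t′ → i < t′ → Position t

      position : ∀ t → Position t
      position t with t ≤? i
      ... | yes t≤i = before t≤i
      ... | no  t≰i = beyond t (≰⇒> t≰i)
        where
        beyond : ∀ t → i < t → Position t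
        beyond (suc t′) i<1+t′ with m≤n⇒m<n∨m≡n (≤-pred i<1+t′)
        ... | inj₁ i<t′ = after t′ refl i<t′
        ... | inj₂ refl = at refl

      distinct : DistinctIterates (insert g p) (embed w) (suc s)
      distinct a b a<b b<1+s eq with position a | position b
      ... | before a≤i | before b≤i =
        O-distinct a b a<b (≤-<-trans b≤i i<s) (embed-injective (trans (sym (F-before a a≤i)) (trans eq (F-before b b≤i))))
      ... | before a≤i | at refl = embed≢u (O a) (trans (sym (F-before a a≤i)) (trans eq F-at))
      ... | before a≤i | after b′ refl i<b′ =
        O-distinct a b′ (≤-<-trans a≤i i<b′) (≤-pred b<1+s)
          (embed-injective (trans (sym (F-before a a≤i)) (trans eq (F-after b′ i<b′ (<⇒≤ (≤-pred b<1+s))))))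
      ... | at refl | before b≤i = <⇒≱ (<-trans (n<1+n i) a<b) b≤i
      ... | at refl | at refl = <-irrefl refl a<b
      ... | at refl | after b′ refl i<b′ =
        embed≢u (O b′) (trans (sym (F-after b′ i<b′ (<⇒≤ (≤-pred b<1+s)))) (trans (sym eq) F-at))
      ... | after a′ refl i<a′ | before b≤i = <⇒≱ (<-trans i<a′ (<-trans (n<1+n a′) a<b)) b≤i
      ... | after a′ refl i<a′ | at refl = <⇒≱ a<b (s≤s (<⇒≤ i<a′))
      ... | after a′ refl i<a′ | after b′ refl i<b′ =
        O-distinct a′ b′ (≤-pred a<b) (≤-pred b<1+s)
          (embed-injective (trans (sym (F-after a′ i<a′ (<⇒≤ (<-trans (≤-pred a<b) (≤-pred b<1+s)))))
                                  (trans eq (F-after b′ i<b′ (<⇒≤ (≤-pred b<1+s))))))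

      returns : Returns (insert g p) (embed w) (suc s)
      returns with j , j<s , Os≡Oj ← proj₂ (sixLen-spec g w) | j ≤? i
      ... | yes j≤i = j , <-trans j<s (n<1+n s) ,
                      trans (F-after s i<s ≤-refl) (trans (cong embed Os≡Oj) (sym (F-before j j≤i)))
      ... | no j≰i  = suc j , s≤s j<s ,
                      trans (F-after s i<s ≤-refl) (trans (cong embed Os≡Oj) (sym (F-after j (≰⇒> j≰i) (<⇒≤ j<s))))

      sixLen-insert : sixLen (insert g p) (embed w) ≡ suc s
      sixLen-insert = sixLen-unique (insert g p) (embed w) distinct returns

    onOrbit : Fin (suc N) → Bool
    onOrbit p = any (λ j → p == embed (O j)) (upTo s)

    sixLen-insert : ∀ p → sixLen (insert g p) (embed w) ≡ (if onOrbit p then suc s else s)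
    sixLen-insert p with onOrbit p in on?
    ... | true  with j , j∈ , p≡Oj ← find (any⁻ _ (upTo s) (subst T (sym on?) _)) =
      OnOrbit.sixLen-insert p (∈-upTo⁻ j∈) (toWitness p≡Oj)
    ... | false = OffOrbit.sixLen-insert p off
      where
      off : ∀ {j} → j < s → embed (O j) ≢ p
      off j<s Oj≡p = subst T on? (any⁺ _ (lose (∈-upTo⁺ j<s) (fromWitness (sym Oj≡p))))

    hits : Fin (suc N) → ℕ
    hits p = ∑[ j ∈ upTo s ] 𝟙 (p == embed (O j))

    𝟙-onOrbit : ∀ p → 𝟙 (onOrbit p) ≡ hits p
    𝟙-onOrbit p with onOrbit p in on?
    ... | true with j , j∈ , p≡Oj ← find (any⁻ _ (upTo s) (subst T (sym on?) _)) =
      sym (trans (∑-cong-∈ (upTo s) (cong 𝟙 ∘ same-index)) (upTo-counts (∈-upTo⁻ j∈)))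
      where
      same-index : ∀ {j′} → j′ ∈ upTo s → (p == embed (O j′)) ≡ (j ≡ᵇ j′)
      same-index {j′} j′∈ = T-⇔⇒≡
        (λ p≡Oj′ → ≡⇒≡ᵇ j j′ (O-injective (∈-upTo⁻ j∈) (∈-upTo⁻ j′∈)
                                (embed-injective (trans (sym (toWitness p≡Oj)) (toWitness p≡Oj′)))))
        (λ j≡j′ → fromWitness (trans (toWitness p≡Oj) (cong (embed ∘ O) (≡ᵇ⇒≡ j j′ j≡j′))))
    ... | false = sym (trans (∑-cong-∈ (upTo s) miss) (∑-zero (upTo s)))
      where
      miss : ∀ {j} → j ∈ upTo s → 𝟙 (p == embed (O j)) ≡ 0
      miss j∈ = cong 𝟙 (==-≢ λ p≡Oj → subst T on? (any⁺ _ (lose j∈ (fromWitness p≡Oj))))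

    ∑-onOrbit : ∑[ p ∈ allFin (suc N) ] 𝟙 (onOrbit p) ≡ s
    ∑-onOrbit = begin
      ∑[ p ∈ allFin (suc N) ] 𝟙 (onOrbit p)
        ≡⟨ ∑-cong (allFin (suc N)) 𝟙-onOrbit ⟩
      ∑[ p ∈ allFin (suc N) ] ∑[ j ∈ upTo s ] 𝟙 (p == embed (O j))
        ≡⟨ ∑-comm (allFin (suc N)) (upTo s) (λ p j → 𝟙 (p == embed (O j))) ⟩
      ∑[ j ∈ upTo s ] ∑[ p ∈ allFin (suc N) ] 𝟙 (p == embed (O j))
        ≡⟨ ∑-cong (upTo s) (allFin-enumerates (suc N) ∘ embed ∘ O) ⟩
      ∑[ j ∈ upTo s ] 1
        ≡⟨ trans (∑-const (upTo s) 1) (trans (*-identityʳ _) (length-upTo s)) ⟩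
      s ∎

    ∑-offOrbit : ∑[ p ∈ allFin (suc N) ] 𝟙 (not (onOrbit p)) ≡ suc N ∸ s
    ∑-offOrbit = begin
      Off                                                        ≡⟨ sym (m+n∸m≡n s Off) ⟩
      s + Off ∸ s                                                ≡⟨ cong (λ m → m + Off ∸ s) (sym ∑-onOrbit) ⟩
      ∑ (allFin (suc N)) (𝟙 ∘ onOrbit) + Off ∸ s
        ≡⟨ cong (_∸ s) (sym (∑-distrib-+ (allFin (suc N)) (𝟙 ∘ onOrbit) (𝟙 ∘ not ∘ onOrbit))) ⟩
      ∑[ p ∈ allFin (suc N) ] (𝟙 (onOrbit p) + 𝟙 (not (onOrbit p))) ∸ s
        ≡⟨ cong (_∸ s) (trans (∑-cong (allFin (suc N)) (𝟙-+-𝟙-not ∘ onOrbit)) (∑-allFin-1 (suc N))) ⟩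
      suc N ∸ s                                                  ∎
      where
      Off = ∑[ p ∈ allFin (suc N) ] 𝟙 (not (onOrbit p))

    ∑-sixLen-insert : ∀ k → ∑[ p ∈ allFin (suc N) ] 𝟙 (sixLen (insert g p) (embed w) ≡ᵇ k) ≡ urnNum 1 s (suc N ∸ s) k
    ∑-sixLen-insert k = begin
      ∑[ p ∈ allFin (suc N) ] 𝟙 (sixLen (insert g p) (embed w) ≡ᵇ k)
        ≡⟨ ∑-cong (allFin (suc N)) term ⟩
      ∑[ p ∈ allFin (suc N) ] (𝟙 (onOrbit p) * grown + 𝟙 (not (onOrbit p)) * kept)
        ≡⟨ ∑-distrib-+ (allFin (suc N)) (λ p → 𝟙 (onOrbit p) * grown) (λ p → 𝟙 (not (onOrbit p)) * kept) ⟩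
      ∑[ p ∈ allFin (suc N) ] (𝟙 (onOrbit p) * grown) + ∑[ p ∈ allFin (suc N) ] (𝟙 (not (onOrbit p)) * kept)
        ≡⟨ cong₂ _+_ (trans (*-distribʳ-∑ (allFin (suc N)) grown (𝟙 ∘ onOrbit)) (cong (_* grown) ∑-onOrbit))
                     (trans (*-distribʳ-∑ (allFin (suc N)) kept (𝟙 ∘ not ∘ onOrbit)) (cong (_* kept) ∑-offOrbit)) ⟩
      s * grown + (suc N ∸ s) * kept ∎
      where
      grown = 𝟙 (suc s ≡ᵇ k)
      kept = 𝟙 (s ≡ᵇ k)
      term : ∀ p → 𝟙 (sixLen (insert g p) (embed w) ≡ᵇ k) ≡ 𝟙 (onOrbit p) * grown + 𝟙 (not (onOrbit p)) * kept
      term p rewrite sixLen-insert p with onOrbit p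
      ... | true  = sym (trans (+-identityʳ (grown + 0)) (+-identityʳ grown))
      ... | false = sym (+-identityʳ kept)

  module Counting (d : Fin (suc N) → ℕ) (d′ : Fin N → ℕ) (d-u : d u ≡ 1) (d-embed : ∀ x → d (embed x) ≡ d′ x) where

    ∑-hasDegSeq-insert : (H : (Fin (suc N) → Fin (suc N)) → ℕ) → (∀ {f f′} → f ≗ f′ → H f ≡ H f′) →
      ∑[ f ∈ funs (suc N) (suc N) ] (𝟙 (hasDegSeq d f) * H f) ≡
      ∑[ g ∈ funs N N ] (𝟙 (hasDegSeq d′ g) * ∑[ p ∈ allFin (suc N) ] H (insert g p))
    ∑-hasDegSeq-insert H H-cong = begin
      ∑[ f ∈ funs (suc N) (suc N) ] W f
        ≡⟨ ∑-reindex (≗-decSetoid (suc N) (suc N)) (×-decSetoid (≗-decSetoid N N) (Fin-decSetoid (suc N)))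
             (funs (suc N) (suc N)) (cartesianProduct (funs N N) (allFin (suc N)))
             (funs-enumerates (suc N) (suc N))
             (×-enumerates (≗-decSetoid N N) (Fin-decSetoid (suc N)) (funs N N) (allFin (suc N))
                           (funs-enumerates N N) (allFin-enumerates (suc N)))
             (λ (g , p) → insert g p) insert-cong₂ insert-injective W W-cong support ⟩
      ∑[ (g , p) ∈ cartesianProduct (funs N N) (allFin (suc N)) ] W (insert g p)
        ≡⟨ ∑-cartesianProduct (funs N N) (allFin (suc N)) (λ (g , p) → W (insert g p)) ⟩
      ∑[ g ∈ funs N N ] ∑[ p ∈ allFin (suc N) ] (𝟙 (hasDegSeq d (insert g p)) * H (insert g p))
        ≡⟨ ∑-cong (funs N N) (λ g →
             trans (∑-cong (allFin (suc N)) (λ p → cong (λ b → 𝟙 b * H (insert g p)) (hasDegSeq-insert d d′ d-u d-embed g p)))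
                   (*-distribˡ-∑ (allFin (suc N)) (𝟙 (hasDegSeq d′ g)) (H ∘ insert g))) ⟩
      ∑[ g ∈ funs N N ] (𝟙 (hasDegSeq d′ g) * ∑[ p ∈ allFin (suc N) ] H (insert g p)) ∎
      where
      W : (Fin (suc N) → Fin (suc N)) → ℕ
      W f = 𝟙 (hasDegSeq d f) * H f
      W-cong : ∀ {f f′} → f ≗ f′ → W f ≡ W f′
      W-cong f≗f′ = cong₂ _*_ (cong 𝟙 (hasDegSeq-cong d f≗f′)) (H-cong f≗f′)
      insert-cong₂ : ∀ {(g , p) (g′ , p′) : (Fin N → Fin N) × Fin (suc N)} → g ≗ g′ × p ≡ p′ → insert g p ≗ insert g′ p′
      insert-cong₂ (g≗g′ , refl) = insert-cong g≗g′
      support : ∀ f → W f ≡ 0 ⊎ ∃ λ ((g , p) : (Fin N → Fin N) × Fin (suc N)) → f ≗ insert g p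
      support f with hasDegSeq d f in degrees
      ... | false = inj₁ refl
      ... | true  = inj₂ (insert-surjective d d′ d-u d-embed f (subst T (sym degrees) _))

    FGCount-insert : FGCount (suc N) d ≡ FGCount N d′ * suc N
    FGCount-insert = begin
      FGCount (suc N) d
        ≡⟨ FGCount≡∑ (suc N) d ⟩
      ∑[ f ∈ funs (suc N) (suc N) ] 𝟙 (hasDegSeq d f)
        ≡⟨ ∑-cong (funs (suc N) (suc N)) (λ f → sym (*-identityʳ _)) ⟩
      ∑[ f ∈ funs (suc N) (suc N) ] (𝟙 (hasDegSeq d f) * 1)
        ≡⟨ ∑-hasDegSeq-insert (λ _ → 1) (λ _ → refl) ⟩
      ∑[ g ∈ funs N N ] (𝟙 (hasDegSeq d′ g) * ∑[ p ∈ allFin (suc N) ] 1)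
        ≡⟨ ∑-cong (funs N N) (λ g → cong (𝟙 (hasDegSeq d′ g) *_) (∑-allFin-1 (suc N))) ⟩
      ∑[ g ∈ funs N N ] (𝟙 (hasDegSeq d′ g) * suc N)
        ≡⟨ *-distribʳ-∑ (funs N N) (suc N) (𝟙 ∘ hasDegSeq d′) ⟩
      ∑[ g ∈ funs N N ] 𝟙 (hasDegSeq d′ g) * suc N
        ≡⟨ cong (_* suc N) (sym (FGCount≡∑ N d′)) ⟩
      FGCount N d′ * suc N ∎

    SixLenCount-insert : ∀ w k → SixLenCount (suc N) d (embed w) k ≡
                         ∑[ j ∈ upTo (suc N) ] (SixLenCount N d′ w j * urnNum 1 j (suc N ∸ j) k)
    SixLenCount-insert w k = begin
      SixLenCount (suc N) d (embed w) k
        ≡⟨ SixLenCount≡∑ (suc N) d (embed w) k ⟩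
      ∑[ f ∈ funs (suc N) (suc N) ] (𝟙 (hasDegSeq d f) * H f)
        ≡⟨ ∑-hasDegSeq-insert H (λ f≗f′ → cong (λ t → 𝟙 (t ≡ᵇ k)) (sixLen-cong f≗f′ (embed w))) ⟩
      ∑[ g ∈ funs N N ] (D g * ∑[ p ∈ allFin (suc N) ] H (insert g p))
        ≡⟨ ∑-cong (funs N N) (λ g → cong (D g *_) (Orbit.∑-sixLen-insert g w k)) ⟩
      ∑[ g ∈ funs N N ] (D g * U (sixLen g w))
        ≡⟨ ∑-cong (funs N N) (λ g → cong (D g *_) (sym (∑-upTo-select (s≤s (sixLen≤n g w)) U))) ⟩
      ∑[ g ∈ funs N N ] (D g * ∑[ j ∈ upTo (suc N) ] (𝟙 (sixLen g w ≡ᵇ j) * U j))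
        ≡⟨ ∑-cong (funs N N) (λ g → sym (trans (∑-cong (upTo (suc N)) (λ j → *-assoc (D g) _ (U j)))
                                               (*-distribˡ-∑ (upTo (suc N)) (D g) _))) ⟩
      ∑[ g ∈ funs N N ] ∑[ j ∈ upTo (suc N) ] (D g * 𝟙 (sixLen g w ≡ᵇ j) * U j)
        ≡⟨ ∑-comm (funs N N) (upTo (suc N)) (λ g j → D g * 𝟙 (sixLen g w ≡ᵇ j) * U j) ⟩
      ∑[ j ∈ upTo (suc N) ] ∑[ g ∈ funs N N ] (D g * 𝟙 (sixLen g w ≡ᵇ j) * U j)
        ≡⟨ ∑-cong (upTo (suc N)) (λ j → trans (*-distribʳ-∑ (funs N N) (U j) _)
                                              (cong (_* U j) (sym (SixLenCount≡∑ N d′ w j)))) ⟩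
      ∑[ j ∈ upTo (suc N) ] (SixLenCount N d′ w j * U j) ∎
      where
      H : (Fin (suc N) → Fin (suc N)) → ℕ
      H f = 𝟙 (sixLen f (embed w) ≡ᵇ k)
      D : (Fin N → Fin N) → ℕ
      D g = 𝟙 (hasDegSeq d′ g)
      U : ℕ → ℕ
      U j = urnNum 1 j (suc N ∸ j) k

-- Removing the vertices outside the image of e

module _ {A B : Set} (is : List A) (js : List B) where

  mixture-compose : (c : B → ℕ) (a : A → ℕ) (K : A → B → ℕ) (U : B → ℕ) (T D T′ M : ℕ) →
    (∀ j → c j * T * D ≡ T′ * ∑[ i ∈ is ] (a i * K i j)) →
    ∑[ j ∈ js ] (c j * U j) * T * (D * M) ≡ T′ * M * ∑[ i ∈ is ] (a i * ∑[ j ∈ js ] (K i j * U j))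
  mixture-compose c a K U T D T′ M mix = begin
    ∑[ j ∈ js ] (c j * U j) * T * (D * M)
      ≡⟨ reassociate (∑[ j ∈ js ] (c j * U j)) T D M ⟩
    ∑[ j ∈ js ] (c j * U j) * (T * D) * M
      ≡⟨ cong (_* M) (sym (*-distribʳ-∑ js (T * D) (λ j → c j * U j))) ⟩
    ∑[ j ∈ js ] (c j * U j * (T * D)) * M
      ≡⟨ cong (_* M) (∑-cong js (λ j → trans (move-U (c j) (U j) T D) (cong (_* U j) (mix j)))) ⟩
    ∑[ j ∈ js ] (T′ * ∑[ i ∈ is ] (a i * K i j) * U j) * M
      ≡⟨ cong (_* M) (trans (∑-cong js (λ j → *-assoc T′ _ (U j)))
                            (*-distribˡ-∑ js T′ (λ j → ∑[ i ∈ is ] (a i * K i j) * U j))) ⟩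
    T′ * ∑[ j ∈ js ] (∑[ i ∈ is ] (a i * K i j) * U j) * M
      ≡⟨ cong (λ x → T′ * x * M) exchange ⟩
    T′ * ∑[ i ∈ is ] (a i * ∑[ j ∈ js ] (K i j * U j)) * M
      ≡⟨ swap-last T′ (∑[ i ∈ is ] (a i * ∑[ j ∈ js ] (K i j * U j))) M ⟩
    T′ * M * ∑[ i ∈ is ] (a i * ∑[ j ∈ js ] (K i j * U j)) ∎
    where
    open ≡-Reasoning
    reassociate : ∀ x t d m → x * t * (d * m) ≡ x * (t * d) * m
    reassociate = solve-∀
    move-U : ∀ x u t d → x * u * (t * d) ≡ x * t * d * u
    move-U = solve-∀
    swap-last : ∀ t x m → t * x * m ≡ t * m * x
    swap-last = solve-∀
    exchange : ∑[ j ∈ js ] (∑[ i ∈ is ] (a i * K i j) * U j) ≡ ∑[ i ∈ is ] (a i * ∑[ j ∈ js ] (K i j * U j))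
    exchange = begin
      ∑[ j ∈ js ] (∑[ i ∈ is ] (a i * K i j) * U j)
        ≡⟨ ∑-cong js (λ j → sym (*-distribʳ-∑ is (U j) (λ i → a i * K i j))) ⟩
      ∑[ j ∈ js ] ∑[ i ∈ is ] (a i * K i j * U j)
        ≡⟨ ∑-comm js is (λ j i → a i * K i j * U j) ⟩
      ∑[ i ∈ is ] ∑[ j ∈ js ] (a i * K i j * U j)
        ≡⟨ ∑-cong is (λ i → trans (∑-cong js (λ j → *-assoc (a i) (K i j) (U j)))
                                  (*-distribˡ-∑ js (a i) (λ j → K i j * U j))) ⟩
      ∑[ i ∈ is ] (a i * ∑[ j ∈ js ] (K i j * U j)) ∎

SixLenCount-urn-mixture :
  ∀ m n̂ (d : Fin (suc m + n̂) → ℕ) (d̂ : Fin n̂ → ℕ) (e : Fin n̂ → Fin (suc m + n̂)) → Injective _≡_ _≡_ e →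
  (∀ v → (∀ x → e x ≢ v) → d v ≡ 1) → (∀ x → d (e x) ≡ d̂ x) → ∀ w k →
  SixLenCount (suc m + n̂) d (e w) k * FGCount n̂ d̂ * urnDen (suc m) (suc n̂)
    ≡ FGCount (suc m + n̂) d * ∑[ j ∈ upTo (suc n̂) ] (SixLenCount n̂ d̂ w j * urnNum (suc m) j (suc n̂ ∸ j) k)
SixLenCount-urn-mixture m n̂ d d̂ e e-injective unit-outside d-e w k
  with injective-<⇒missing e-injective (s≤s (m≤n+m n̂ m))
SixLenCount-urn-mixture zero n̂ d d̂ e e-injective unit-outside d-e w k | u , u∉e = begin
  SixLenCount (suc n̂) d (e w) k * T̂ * urnDen 1 (suc n̂)
    ≡⟨ cong (λ x → x * T̂ * urnDen 1 (suc n̂)) (SixLenCount-insert w k) ⟩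
  Σ * T̂ * (suc n̂ * 1)
    ≡⟨ rearrange Σ T̂ (suc n̂) ⟩
  T̂ * suc n̂ * Σ
    ≡⟨ cong (_* Σ) (sym FGCount-insert) ⟩
  FGCount (suc n̂) d * Σ ∎
  where
  open ≡-Reasoning
  open Insertion (complement e e-injective u∉e w)
  open Counting d d̂ (unit-outside u u∉e) d-e
  T̂ = FGCount n̂ d̂
  Σ = ∑[ j ∈ upTo (suc n̂) ] (SixLenCount n̂ d̂ w j * urnNum 1 j (suc n̂ ∸ j) k)
  rearrange : ∀ x t n → x * t * (n * 1) ≡ t * n * x
  rearrange = solve-∀
SixLenCount-urn-mixture (suc m) n̂ d d̂ e e-injective unit-outside d-e w k | u , u∉e = begin
  SixLenCount (suc N) d (e w) k * T̂ * urnDen (suc (suc m)) (suc n̂)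
    ≡⟨ cong₂ (λ x y → x * T̂ * y)
             (trans (cong (λ v → SixLenCount (suc N) d v k) (sym (embed-e′ w))) (SixLenCount-insert (e′ w) k))
             (trans (urnDen-suc (suc m) (suc n̂)) (cong (D *_) all-balls)) ⟩
  ∑[ j ∈ upTo (suc N) ] (SixLenCount N d′ (e′ w) j * U j) * T̂ * (D * suc N)
    ≡⟨ mixture-compose (upTo (suc n̂)) (upTo (suc N)) (SixLenCount N d′ (e′ w)) a K U T̂ D (FGCount N d′) (suc N)
         (SixLenCount-urn-mixture m n̂ d′ d̂ e′ (retract∘-injective u∉e e-injective) unit-outside′ d-e′ w) ⟩
  FGCount N d′ * suc N * ∑[ i ∈ upTo (suc n̂) ] (a i * ∑[ j ∈ upTo (suc N) ] (K i j * U j))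
    ≡⟨ cong₂ _*_ (sym FGCount-insert)
                 (∑-cong-∈ (upTo (suc n̂)) (λ {i} i∈ → cong (a i *_) (urn-step (∈-upTo⁻ i∈)))) ⟩
  FGCount (suc N) d * ∑[ i ∈ upTo (suc n̂) ] (a i * urnNum (suc (suc m)) i (suc n̂ ∸ i) k) ∎
  where
  open ≡-Reasoning
  N = suc m + n̂
  C : Complement u
  C = complement (punchIn u) (punchIn-injective u _ _) (punchInᵢ≢i u) zero
  open Complement C
  open Insertion C
  d′ = d ∘ embed
  open Counting d d′ (unit-outside u u∉e) (λ _ → refl)
  e′ : Fin n̂ → Fin N
  e′ = retract ∘ e
  embed-e′ : ∀ x → embed (e′ x) ≡ e x
  embed-e′ x = embed-retract (u∉e x)
  unit-outside′ : ∀ v → (∀ x → e′ x ≢ v) → d′ v ≡ 1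
  unit-outside′ v v∉e′ =
    unit-outside (embed v) (λ x ex≡ev → v∉e′ x (trans (cong retract ex≡ev) (retract-embed v)))
  d-e′ : ∀ x → d′ (e′ x) ≡ d̂ x
  d-e′ x = trans (cong d (embed-e′ x)) (d-e x)
  T̂ = FGCount n̂ d̂
  D = urnDen (suc m) (suc n̂)
  all-balls : suc n̂ + suc m ≡ suc N
  all-balls = trans (+-comm (suc n̂) (suc m)) (cong suc (+-suc m n̂))
  a : ℕ → ℕ
  a = SixLenCount n̂ d̂ w
  K : ℕ → ℕ → ℕ
  K i = urnNum (suc m) i (suc n̂ ∸ i)
  U : ℕ → ℕ
  U j = urnNum 1 j (suc N ∸ j) k
  urn-step : ∀ {i} → i < suc n̂ → ∑[ j ∈ upTo (suc N) ] (K i j * U j) ≡ urnNum (suc (suc m)) i (suc n̂ ∸ i) k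
  urn-step {i} i<1+n̂ =
    urnNum-suc (suc m) i (suc n̂ ∸ i) k (trans (cong (_+ suc m) (m+[n∸m]≡n (<⇒≤ i<1+n̂))) all-balls)
               (s≤s (subst (i + suc m ≤_) (+-comm n̂ (suc m)) (+-monoˡ-≤ (suc m) (≤-pred i<1+n̂))))

m<n⇒n≡1+[n∸1+m]+m : ∀ {m n} → m < n → n ≡ suc (n ∸ suc m) + m
m<n⇒n≡1+[n∸1+m]+m {m} {n} m<n = sym (trans (sym (+-suc (n ∸ suc m) m)) (m∸n+n≡m m<n))

corollary4p7 :
    (n : ℕ) (d : Fin n → ℕ) → ΣF n d ≡ n →
    (w : Fin n) →
    (n̂ : ℕ) → n̂ ^ 3 ≤ nσ² n d ^ 4 → nσ² n d ^ 4 < suc n̂ ^ 3 →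
    n̂ < n →
    (e : Fin n̂ → Fin n) → Injective _≡_ _≡_ e →
    (∀ v → (∀ i → e i ≢ v) → d v ≡ 1) →
    (w′ : Fin n̂) → e w′ ≡ w →
    (k : ℕ) →
    SixLenCount n d w k * FGCount n̂ (d ∘ e) * urnDen (n ∸ n̂) (suc n̂)
      ≡ FGCount n d
        * sum (map (λ j → SixLenCount n̂ (d ∘ e) w′ j * urnNum (n ∸ n̂) j (suc n̂ ∸ j) k)
                   (upTo (suc n̂)))
corollary4p7 n d _ w n̂ _ _ n̂<n e e-injective unit-outside w′ refl k with n ∸ suc n̂ | m<n⇒n≡1+[n∸1+m]+m n̂<n
... | m | refl rewrite m+n∸n≡m (suc m) n̂ =
  SixLenCount-urn-mixture m n̂ d (d ∘ e) e e-injective unit-outside (λ _ → refl) w′ k
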